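{- Let $t_n=(-1)^{s_2(n)}$, $h_0=0$, $h_1=1$, and $h_n=t_nh_{n-1}+h_{n-2}$ for $n\ge2$. For each integer $m\ge 2$ the congruence $h_n\equiv 0\pmod m$ has infinitely many solutions $n\in\mathbb{N}_{+}$.
   Context: $s_2(n)$ denotes the number of 1's in the binary expansion of $n$; $(t_n)$ is the Prouhet–Thue–Morse sequence. -}

module Defs where

open import Data.Nat using (ℕ; zero; suc; _+_; ⌊_/2⌋)
open import Data.Nat.DivMod using (_%_)
open import Data.Integer using (ℤ; +_; -_; _*_) renaming (_+_ to _+ℤ_)

-- binary digit sum, computed with fuel (fuel k suffices whenever n ≤ k)
s₂-aux : ℕ → ℕ → ℕ
s₂-aux zero    n = 0
s₂-aux (suc k) zero = 0
s₂-aux (suc k) n@(suc _) = n % 2 + s₂-aux k ⌊ n /2⌋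

s₂ : ℕ → ℕ
s₂ n = s₂-aux n n

neg1^ : ℕ → ℤ
neg1^ zero    = + 1
neg1^ (suc k) = - neg1^ k

t : ℕ → ℤ
t n = neg1^ (s₂ n)

h : ℕ → ℤ
h zero = + 0
h (suc zero) = + 1
h (suc (suc n)) = t (suc (suc n)) * h (suc n) +ℤ h n

-- Write hₙ₋₁, hₙ₋₂ as a state advanced by one step per index n; step n depends only on tₙ
-- and is invertible. Since t(2ᵏc + i) = t(c)·t(i) for i < 2ᵏ, whenever t(c) = 1 the steps
-- at the indices 2ᵏc, …, 2ᵏc + 2ᵏ − 1 repeat those at 0, …, 2ᵏ − 1. By pigeonhole two of
-- the states reached after 2^(K+2i) steps (i = 0, …, m²) agree mod m, say at 2ᵏ and at
-- 2ᵏ⁺²ᵉ = 2ᵏc + 2ᵏ with c = 2²ᵉ − 1, which has t(c) = 1. Cancelling the common block of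
-- 2ᵏ steps shows that the state after 2ᵏc steps is the initial one mod m, so the sequence
-- restarts there mod m and h(2ᵏc + 3) ≡ h(3) = 0.
module Submission where

open import Defs
open import Data.Nat using (ℕ; _≥_; _<_)
open import Data.Integer using (+_)
open import Data.Integer.Divisibility using (_∣_)
open import Data.Product using (∃-syntax; _×_)

open import Data.Nat using (zero; suc; _+_; _*_; _^_; _≤_; z<s; s≤s; s≤s⁻¹; ⌊_/2⌋; NonZero)
open import Data.Nat.Properties
open import Data.Nat.DivMod using (_%_; [m+kn]%n≡m%n)
import Data.Nat.Tactic.RingSolver as ℕ-Solver
open import Data.Integer using (ℤ; -_; _-_) renaming (_+_ to _+ℤ_; _*_ to _*ℤ_)
import Data.Integer.Properties as ℤ
open import Data.Integer.DivMod using (_/_; a≡a%n+[a/n]*n; n%d<d) renaming (_%_ to _%ℤ_)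
import Data.Integer.Divisibility.Signed as Signed
import Data.Integer.Tactic.RingSolver as ℤ-Solver
open import Data.Fin using (Fin; toℕ; fromℕ<; combine)
open import Data.Fin.Properties using (toℕ-fromℕ<; combine-injectiveˡ; combine-injectiveʳ; pigeonhole)
open import Data.Product using (∃₂; _,_; proj₁)
open import Relation.Binary.PropositionalEquality

s₂-aux-fuel : ∀ {n k k′} → n ≤ k → n ≤ k′ → s₂-aux k n ≡ s₂-aux k′ n
s₂-aux-fuel {zero} {zero}  {zero}   _       _        = refl
s₂-aux-fuel {zero} {zero}  {suc _}  _       _        = refl
s₂-aux-fuel {zero} {suc _} {zero}   _       _        = refl
s₂-aux-fuel {zero} {suc _} {suc _}  _       _        = refl
s₂-aux-fuel {suc n} {suc k} {suc k′} (s≤s n≤k) (s≤s n≤k′) =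
  cong (_+_ (suc n % 2)) (s₂-aux-fuel (≤-trans half≤n n≤k) (≤-trans half≤n n≤k′))
  where
  half≤n : ⌊ suc n /2⌋ ≤ n
  half≤n = s≤s⁻¹ (⌊n/2⌋<n n)

s₂-suc : ∀ n → s₂ (suc n) ≡ suc n % 2 + s₂ ⌊ suc n /2⌋
s₂-suc n = cong (_+_ (suc n % 2)) (s₂-aux-fuel (s≤s⁻¹ (⌊n/2⌋<n n)) ≤-refl)

n+n≡n*2 : ∀ n → n + n ≡ n * 2
n+n≡n*2 n = trans (cong (_+_ n) (sym (+-identityʳ n))) (*-comm 2 n)

[n+n]%2≡0 : ∀ n → (n + n) % 2 ≡ 0
[n+n]%2≡0 n = trans (cong (_% 2) (n+n≡n*2 n)) ([m+kn]%n≡m%n 0 n 2)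

[1+n+n]%2≡1 : ∀ n → suc (n + n) % 2 ≡ 1
[1+n+n]%2≡1 n = trans (cong (λ x → suc x % 2) (n+n≡n*2 n)) ([m+kn]%n≡m%n 1 n 2)

s₂[n+n]≡s₂[n] : ∀ n → s₂ (n + n) ≡ s₂ n
s₂[n+n]≡s₂[n] zero    = refl
s₂[n+n]≡s₂[n] (suc n) = begin
  s₂ (suc (n + suc n))                                ≡⟨ s₂-suc (n + suc n) ⟩
  suc (n + suc n) % 2 + s₂ ⌊ suc n + suc n /2⌋         ≡⟨ cong₂ (λ r h → r + s₂ h) ([n+n]%2≡0 (suc n)) (sym (n≡⌊n+n/2⌋ (suc n))) ⟩
  s₂ (suc n)                                          ∎
  where open ≡-Reasoning

s₂[1+n+n]≡1+s₂[n] : ∀ n → s₂ (suc (n + n)) ≡ suc (s₂ n)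
s₂[1+n+n]≡1+s₂[n] n = begin
  s₂ (suc (n + n))                              ≡⟨ s₂-suc (n + n) ⟩
  suc (n + n) % 2 + s₂ ⌊ suc (n + n) /2⌋         ≡⟨ cong₂ (λ r h → r + s₂ h) ([1+n+n]%2≡1 n) (sym (n≡⌈n+n/2⌉ n)) ⟩
  suc (s₂ n)                                    ∎
  where open ≡-Reasoning

data Halves : ℕ → Set where
  even : ∀ j → Halves (j + j)
  odd  : ∀ j → Halves (suc (j + j))

halves : ∀ n → Halves n
halves zero = even 0
halves (suc n) with halves n
... | even j = odd j
... | odd j  = subst Halves (cong suc (+-suc j j)) (even (suc j))

j+j<2a⇒j<a : ∀ {j a} → j + j < 2 * a → j < a
j+j<2a⇒j<a {j} {a} p = *-cancelˡ-< 2 j a (subst (_< 2 * a) (cong (_+_ j) (sym (+-identityʳ j))) p)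

s₂[2^k*q+i]≡s₂[q]+s₂[i] : ∀ k q i → i < 2 ^ k → s₂ (2 ^ k * q + i) ≡ s₂ q + s₂ i
s₂[2^k*q+i]≡s₂[q]+s₂[i] zero q .zero z<s =
  trans (cong s₂ (trans (+-identityʳ (1 * q)) (*-identityˡ q))) (sym (+-identityʳ (s₂ q)))
s₂[2^k*q+i]≡s₂[q]+s₂[i] (suc k) q i i<2^[1+k] with halves i
... | even j = begin
  s₂ (2 * 2 ^ k * q + (j + j))               ≡⟨ cong s₂ (double (2 ^ k) q j) ⟩
  s₂ ((2 ^ k * q + j) + (2 ^ k * q + j))     ≡⟨ s₂[n+n]≡s₂[n] (2 ^ k * q + j) ⟩
  s₂ (2 ^ k * q + j)                         ≡⟨ s₂[2^k*q+i]≡s₂[q]+s₂[i] k q j (j+j<2a⇒j<a i<2^[1+k]) ⟩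
  s₂ q + s₂ j                                ≡⟨ cong (_+_ (s₂ q)) (sym (s₂[n+n]≡s₂[n] j)) ⟩
  s₂ q + s₂ (j + j)                          ∎
  where
  open ≡-Reasoning
  double : ∀ a q j → 2 * a * q + (j + j) ≡ (a * q + j) + (a * q + j)
  double = ℕ-Solver.solve-∀
... | odd j = begin
  s₂ (2 * 2 ^ k * q + suc (j + j))                ≡⟨ cong s₂ (double+1 (2 ^ k) q j) ⟩
  s₂ (suc ((2 ^ k * q + j) + (2 ^ k * q + j)))    ≡⟨ s₂[1+n+n]≡1+s₂[n] (2 ^ k * q + j) ⟩
  suc (s₂ (2 ^ k * q + j))                        ≡⟨ cong suc (s₂[2^k*q+i]≡s₂[q]+s₂[i] k q j (j+j<2a⇒j<a (<-trans (n<1+n _) i<2^[1+k]))) ⟩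
  suc (s₂ q + s₂ j)                               ≡⟨ sym (+-suc (s₂ q) (s₂ j)) ⟩
  s₂ q + suc (s₂ j)                               ≡⟨ cong (_+_ (s₂ q)) (sym (s₂[1+n+n]≡1+s₂[n] j)) ⟩
  s₂ q + s₂ (suc (j + j))                         ∎
  where
  open ≡-Reasoning
  double+1 : ∀ a q j → 2 * a * q + suc (j + j) ≡ suc ((a * q + j) + (a * q + j))
  double+1 = ℕ-Solver.solve-∀

neg1^-+ : ∀ a b → neg1^ (a + b) ≡ neg1^ a *ℤ neg1^ b
neg1^-+ zero    b = sym (ℤ.*-identityˡ (neg1^ b))
neg1^-+ (suc a) b = trans (cong -_ (neg1^-+ a b)) (ℤ.neg-distribˡ-* (neg1^ a) (neg1^ b))

neg1^[n+n]≡1 : ∀ n → neg1^ (n + n) ≡ + 1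
neg1^[n+n]≡1 zero    = refl
neg1^[n+n]≡1 (suc n) = begin
  - neg1^ (n + suc n)     ≡⟨ cong (λ e → - neg1^ e) (+-suc n n) ⟩
  - - neg1^ (n + n)       ≡⟨ ℤ.neg-involutive _ ⟩
  neg1^ (n + n)           ≡⟨ neg1^[n+n]≡1 n ⟩
  + 1                     ∎
  where open ≡-Reasoning

t[2^k*q+i]≡t[q]*t[i] : ∀ k q i → i < 2 ^ k → t (2 ^ k * q + i) ≡ t q *ℤ t i
t[2^k*q+i]≡t[q]*t[i] k q i i<2^k =
  trans (cong neg1^ (s₂[2^k*q+i]≡s₂[q]+s₂[i] k q i i<2^k)) (neg1^-+ (s₂ q) (s₂ i))

mersenne : ℕ → ℕ
mersenne zero    = 0
mersenne (suc n) = suc (mersenne n + mersenne n)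

1+mersenne[n]≡2^n : ∀ n → suc (mersenne n) ≡ 2 ^ n
1+mersenne[n]≡2^n zero    = refl
1+mersenne[n]≡2^n (suc n) = trans (double+1 (mersenne n)) (cong (2 *_) (1+mersenne[n]≡2^n n))
  where
  double+1 : ∀ x → suc (suc (x + x)) ≡ 2 * suc x
  double+1 = ℕ-Solver.solve-∀

t[mersenne[n+n]]≡1 : ∀ n → t (mersenne (n + n)) ≡ + 1
t[mersenne[n+n]]≡1 n = trans (cong neg1^ (s₂[mersenne] (n + n))) (neg1^[n+n]≡1 n)
  where
  s₂[mersenne] : ∀ n → s₂ (mersenne n) ≡ n
  s₂[mersenne] zero    = refl
  s₂[mersenne] (suc n) = trans (s₂[1+n+n]≡1+s₂[n] (mersenne n)) (cong suc (s₂[mersenne] n))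

2^[k+e]≡2^k*mersenne[e]+2^k : ∀ k e → 2 ^ (k + e) ≡ 2 ^ k * mersenne e + 2 ^ k
2^[k+e]≡2^k*mersenne[e]+2^k k e = begin
  2 ^ (k + e)                       ≡⟨ ^-distribˡ-+-* 2 k e ⟩
  2 ^ k * 2 ^ e                     ≡⟨ cong (2 ^ k *_) (sym (1+mersenne[n]≡2^n e)) ⟩
  2 ^ k * suc (mersenne e)          ≡⟨ *-suc (2 ^ k) (mersenne e) ⟩
  2 ^ k + 2 ^ k * mersenne e        ≡⟨ +-comm (2 ^ k) _ ⟩
  2 ^ k * mersenne e + 2 ^ k        ∎
  where open ≡-Reasoning

n<2^n : ∀ n → n < 2 ^ n
n<2^n zero    = z<s
n<2^n (suc n) = +-mono-≤ (m^n>0 2 n) (subst (suc n ≤_) (sym (+-identityʳ (2 ^ n))) (n<2^n n))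

State : Set
State = ℤ × ℤ

advance : ℤ → State → State
advance τ (x , y) = (τ *ℤ x +ℤ y , x)

step : ℕ → State → State
step n = advance (t n)

steps : ℕ → ℕ → State → State
steps s zero    v = v
steps s (suc L) v = step (s + L) (steps s L v)

-- (h(−1), h(−2)), extending the recurrence backwards, so that steps 0 L w₀ = (h(L−1), h(L−2)).
w₀ : State
w₀ = (+ 1 , - + 1)

steps-w₀ : ∀ n → steps 0 (2 + n) w₀ ≡ (h (1 + n) , h n)
steps-w₀ zero    = refl
steps-w₀ (suc n) = cong (step (2 + n)) (steps-w₀ n)

steps-+ : ∀ s L₁ L₂ v → steps s (L₁ + L₂) v ≡ steps (s + L₁) L₂ (steps s L₁ v)
steps-+ s L₁ zero     v rewrite +-identityʳ L₁ = refl
steps-+ s L₁ (suc L₂) v rewrite +-suc L₁ L₂ | +-assoc s L₁ L₂ = cong (step (s + (L₁ + L₂))) (steps-+ s L₁ L₂ v)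

steps-cong : ∀ s s′ L v → (∀ i → i < L → t (s′ + i) ≡ t (s + i)) → steps s′ L v ≡ steps s L v
steps-cong s s′ zero    v _    = refl
steps-cong s s′ (suc L) v same = cong₂ advance
  (same L (n<1+n L)) (steps-cong s s′ L v (λ i i<L → same i (<-trans i<L (n<1+n L))))

steps-from-block : ∀ k c L v → t c ≡ + 1 → L ≤ 2 ^ k → steps (2 ^ k * c) L v ≡ steps 0 L v
steps-from-block k c L v tc≡1 L≤2^k = steps-cong 0 (2 ^ k * c) L v λ i i<L → begin
  t (2 ^ k * c + i)   ≡⟨ t[2^k*q+i]≡t[q]*t[i] k c i (<-≤-trans i<L L≤2^k) ⟩
  t c *ℤ t i          ≡⟨ cong (_*ℤ t i) tc≡1 ⟩
  + 1 *ℤ t i          ≡⟨ ℤ.*-identityˡ (t i) ⟩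
  t i                 ∎
  where open ≡-Reasoning

module Congruence (m : ℕ) where

  infix 4 _≈_ _≈ₛ_

  _≈_ : ℤ → ℤ → Set
  a ≈ b = + m Signed.∣ a - b

  _≈ₛ_ : State → State → Set
  (x , y) ≈ₛ (x′ , y′) = x ≈ x′ × y ≈ y′

  advance-preserves-≈ : ∀ τ {v v′} → v ≈ₛ v′ → advance τ v ≈ₛ advance τ v′
  advance-preserves-≈ τ {x , y} {x′ , y′} (x≈x′ , y≈y′) =
    subst (+ m Signed.∣_) (sym (difference τ x y x′ y′)) (Signed.∣m∣n⇒∣m+n (Signed.∣n⇒∣m*n τ x≈x′) y≈y′) , x≈x′
    where
    difference : ∀ τ x y x′ y′ → (τ *ℤ x +ℤ y) - (τ *ℤ x′ +ℤ y′) ≡ τ *ℤ (x - x′) +ℤ (y - y′)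
    difference = ℤ-Solver.solve-∀

  advance-reflects-≈ : ∀ τ {v v′} → advance τ v ≈ₛ advance τ v′ → v ≈ₛ v′
  advance-reflects-≈ τ {x , y} {x′ , y′} (τx+y≈τx′+y′ , x≈x′) =
    x≈x′ , subst (+ m Signed.∣_) (sym (difference τ x y x′ y′)) (Signed.∣m∣n⇒∣m-n τx+y≈τx′+y′ (Signed.∣n⇒∣m*n τ x≈x′))
    where
    difference : ∀ τ x y x′ y′ → y - y′ ≡ ((τ *ℤ x +ℤ y) - (τ *ℤ x′ +ℤ y′)) - τ *ℤ (x - x′)
    difference = ℤ-Solver.solve-∀

  steps-preserves-≈ : ∀ s L {v v′} → v ≈ₛ v′ → steps s L v ≈ₛ steps s L v′
  steps-preserves-≈ s zero    v≈v′ = v≈v′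
  steps-preserves-≈ s (suc L) v≈v′ = advance-preserves-≈ (t (s + L)) (steps-preserves-≈ s L v≈v′)

  steps-reflects-≈ : ∀ s L {v v′} → steps s L v ≈ₛ steps s L v′ → v ≈ₛ v′
  steps-reflects-≈ s zero    e = e
  steps-reflects-≈ s (suc L) e = steps-reflects-≈ s L (advance-reflects-≈ (t (s + L)) e)

  steps-return : ∀ k c L v → t c ≡ + 1 → L ≤ 2 ^ k →
                 steps 0 (2 ^ k * c + 2 ^ k) v ≈ₛ steps 0 (2 ^ k) v →
                 steps 0 (2 ^ k * c + L) v ≈ₛ steps 0 L v
  steps-return k c L v tc≡1 L≤2^k returns =
    subst (_≈ₛ steps 0 L v) (sym (split L L≤2^k))
      (steps-preserves-≈ 0 L (steps-reflects-≈ 0 (2 ^ k) (subst (_≈ₛ steps 0 (2 ^ k) v) (split (2 ^ k) ≤-refl) returns)))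
    where
    split : ∀ L → L ≤ 2 ^ k → steps 0 (2 ^ k * c + L) v ≡ steps 0 L (steps 0 (2 ^ k * c) v)
    split L L≤2^k = trans (steps-+ 0 (2 ^ k * c) L v) (steps-from-block k c L (steps 0 (2 ^ k * c) v) tc≡1 L≤2^k)

  h-vanishes-on-return : ∀ k c → t c ≡ + 1 → 4 ≤ 2 ^ k →
                         steps 0 (2 ^ k * c + 2 ^ k) w₀ ≈ₛ steps 0 (2 ^ k) w₀ → h (3 + 2 ^ k * c) ≈ + 0
  h-vanishes-on-return k c tc≡1 4≤2^k returns =
    proj₁ (subst (_≈ₛ steps 0 4 w₀) h-states (steps-return k c 4 w₀ tc≡1 4≤2^k returns))
    where
    h-states : steps 0 (2 ^ k * c + 4) w₀ ≡ (h (3 + 2 ^ k * c) , h (2 + 2 ^ k * c))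
    h-states = trans (cong (λ L → steps 0 L w₀) (+-comm (2 ^ k * c) 4)) (steps-w₀ (2 + 2 ^ k * c))

  h-vanishes-after-repeat : ∀ k e → 4 ≤ 2 ^ k →
                            steps 0 (2 ^ (k + (e + e))) w₀ ≈ₛ steps 0 (2 ^ k) w₀ →
                            h (3 + 2 ^ k * mersenne (e + e)) ≈ + 0
  h-vanishes-after-repeat k e 4≤2^k returns =
    h-vanishes-on-return k (mersenne (e + e)) (t[mersenne[n+n]]≡1 e) 4≤2^k
      (subst (λ L → steps 0 L w₀ ≈ₛ steps 0 (2 ^ k) w₀) (2^[k+e]≡2^k*mersenne[e]+2^k k (e + e)) returns)

  module _ .{{_ : NonZero m}} where

    M : ℤ
    M = + m

    residue : ℤ → Fin m
    residue a = fromℕ< (n%d<d a M)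

    residue-injective : ∀ a b → residue a ≡ residue b → a ≈ b
    residue-injective a b same = Signed.divides (a / M - b / M) (begin
      a - b                                                 ≡⟨ cong₂ _-_ (a≡a%n+[a/n]*n a M) (a≡a%n+[a/n]*n b M) ⟩
      (+ (a %ℤ M) +ℤ a / M *ℤ M) - (+ (b %ℤ M) +ℤ b / M *ℤ M) ≡⟨ cong (λ r → (+ r +ℤ a / M *ℤ M) - (+ (b %ℤ M) +ℤ b / M *ℤ M)) same-% ⟩
      (+ (b %ℤ M) +ℤ a / M *ℤ M) - (+ (b %ℤ M) +ℤ b / M *ℤ M) ≡⟨ cancel (+ (b %ℤ M)) (a / M) (b / M) M ⟩
      (a / M - b / M) *ℤ M                                  ∎)
      where
      open ≡-Reasoning
      same-% : a %ℤ M ≡ b %ℤ M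
      same-% = trans (sym (toℕ-fromℕ< _)) (trans (cong toℕ same) (toℕ-fromℕ< _))
      cancel : ∀ r p q d → (r +ℤ p *ℤ d) - (r +ℤ q *ℤ d) ≡ (p - q) *ℤ d
      cancel = ℤ-Solver.solve-∀

    code : State → Fin (m * m)
    code (x , y) = combine (residue x) (residue y)

    code-injective : ∀ v v′ → code v ≡ code v′ → v ≈ₛ v′
    code-injective (x , y) (x′ , y′) same =
      residue-injective x x′ (combine-injectiveˡ (residue x) (residue y) (residue x′) (residue y′) same) ,
      residue-injective y y′ (combine-injectiveʳ (residue x) (residue y) (residue x′) (residue y′) same)

    states-repeat : (f : ℕ → State) → ∃₂ λ i j → i < j × f j ≈ₛ f i
    states-repeat f with pigeonhole (n<1+n (m * m)) (λ i → code (f (toℕ i)))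
    ... | i , j , i<j , same = toℕ i , toℕ j , i<j , code-injective (f (toℕ j)) (f (toℕ i)) (sym same)

    -- The offset 2 + B makes the repeated block at least 4 long and puts the zero beyond B.
    h-zeros-mod : ∀ B → ∃[ n ] (B < n × + m ∣ h n)
    h-zeros-mod B =
      let i , j , i<j , returns = states-repeat (λ i → steps 0 (2 ^ (2 + B + (i + i))) w₀)
          d , 1+i+d≡j = m≤n⇒∃[o]m+o≡n i<j
          k = 2 + B + (i + i)
          N = 2 ^ k * mersenne (suc d + suc d)
          exponent = trans (cong (λ j → 2 + B + (j + j)) (sym 1+i+d≡j)) (regroup B i d)
      in 3 + N
       , below B k N (≤-trans (m≤n+m B 2) (m≤m+n (2 + B) (i + i))) (m≤m*n (2 ^ k) (mersenne (suc d + suc d)))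
       , Signed.∣⇒∣ᵤ (subst (+ m Signed.∣_) (ℤ.+-identityʳ (h (3 + N)))
           (h-vanishes-after-repeat k (suc d) (*-monoʳ-≤ 2 (*-monoʳ-≤ 2 (m^n>0 2 (B + (i + i)))))
             (subst (λ e → steps 0 (2 ^ e) w₀ ≈ₛ steps 0 (2 ^ k) w₀) exponent returns)))
      where
      regroup : ∀ B i d → 2 + B + ((suc i + d) + (suc i + d)) ≡ (2 + B + (i + i)) + (suc d + suc d)
      regroup = ℕ-Solver.solve-∀
      below : ∀ B k N → B ≤ k → 2 ^ k ≤ N → B < 3 + N
      below B k N B≤k 2^k≤N = begin-strict
        B        <⟨ n<2^n B ⟩
        2 ^ B    ≤⟨ ^-monoʳ-≤ 2 B≤k ⟩
        2 ^ k    ≤⟨ 2^k≤N ⟩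
        N        ≤⟨ m≤n+m N 3 ⟩
        3 + N    ∎
        where open ≤-Reasoning

open Congruence using (h-zeros-mod)

theorem2 : (m : ℕ) → m ≥ 2 → (N : ℕ) → ∃[ n ] (N < n × (+ m) ∣ h n)
theorem2 m@(suc _) _ = h-zeros-mod m
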